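{- For every pushdown compound Kripke structure $\mathcal{P}=(\Gamma,S,R,\ell,s_\iota)$ over $\{L_i\}_{i\in[n]}$ and every $\mathrm{QCTL}^*_i$ formula $\varphi$, $\mathcal{P}\models\varphi$ if and only if the succinct unfolding of $\mathcal{P}$ satisfies (at its root) the formula $\varphi'$ obtained from $\varphi$ by replacing every concrete observation $o\subseteq[n]$ by $o\cup\{n+1\}$.
   Context: $\mathrm{QCTL}^*_i$ over atomic propositions $AP$ and local states $L_1,\dots,L_n$ (pairwise disjoint): state formulas $\varphi::=p\mid\neg\varphi\mid\varphi\vee\varphi\mid\mathbf{E}\psi\mid\exists^op.\varphi$, path formulas $\psi::=\varphi\mid\neg\psi\mid\psi\vee\psi\mid\mathbf{X}\psi\mid\psi\,\mathbf{U}\,\psi$, with $o\subseteq[n+1]$ a concrete observation. Semantics on labelled trees whose directions are tuples indexed by a set $I$ of components: CTL$^*$ semantics at nodes and on infinite downward paths, and $\exists^op.\varphi$ holds at $u$ iff there is a $p$-labelling $f$ of the tree, $o$-uniform (equal on any two nodes of equal length whose letters pairwise agree on all components with index in $o\cap I$), such that $\varphi$ holds at $u$ once $p$'s labelling is replaced by $f$. A compound Kripke structure (CKS) satisfies a formula iff its tree unfolding (finite paths from the initial state, labelled by the last state) satisfies it at the root. A pushdown compound Kripke structure (PCKS) is $\mathcal{P}=(\Gamma,S,R,\ell,s_\iota)$: $\Gamma$ finite with bottom $\bot\notin\Gamma$; $S\subseteq\prod_{i\in[n]}L_i$ finite; $R\subseteq S\times\Gamma_\bot\times S\times\Gamma_\bot^*$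 never removing nor pushing $\bot$; $\ell:S\times\Gamma^*\bot\to2^{AP}$ regular (for each $p,s$ a finite automaton recognises $\{w:p\in\ell(s,w)\}$); $s_\iota\in S$. Configurations $(s,w)$, $w\in\Gamma^*\bot$ with top on the left; $(s,\gamma w)\to(s',w'w)$ iff $(s,\gamma,s',w')\in R$; every configuration has a successor; partial paths are finite sequences of configurations starting at $(s_\iota,\bot)$ following $\to$. $\mathcal{P}$ generates the CKS over $\{L_i\}_{i\in[n+1]}$ with $L_{n+1}=\Gamma^*\bot$, states $S\times\Gamma^*\bot$, transitions $\to$, labelling $\ell$, initial state $(s_\iota,\bot)$; $\mathcal{P}\models\varphi$ iff this CKS satisfies $\varphi'$. Succinct unfolding: let $D_{st}=\{w':(s,\gamma,s',w')\in R\text{ for some }s,\gamma,s'\}\cup\{\epsilon\}$. The succinct representation of a partial path $(s_\iota,\bot)(s_1,w_1)\dots(s_m,w_m)$ is the word $(s_\iota,\bot)(s_1,w'_1)\dots(s_m,w'_m)$ where $w'_{i+1}$ is the word pushed at step $i+1$ (i.e. $w_i=\gamma w''_i$ and $w_{i+1}=w'_{i+1}w''_i$). The succinct unfolding of $\mathcal{P}$ is the tree whose nodes are the succinct representations of all partial paths, each labelled by $\ell(s_m,w_m)$ where $(s_m,w_m)$ is the last configuration of the corresponding partial path. Its directions are regarded as tuples in $\prod_{i\in[n]}L_i\times L'_{n+1}$ whose $(n+1)$-th component is the pushed word (or $\bot$ at the root). -}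

module Defs where

open import Data.Nat using (ℕ; zero; suc; _<_; _+_)
open import Data.Fin using (Fin; inject₁; fromℕ)
open import Data.Fin.Subset using (Subset; _∈_; _∪_; ⁅_⁆; outside)
import Data.Vec as V
open import Data.List using (List; []; _∷_; _++_; map; foldl)
import Data.List as L
open import Data.List.Relation.Binary.Pointwise using (Pointwise)
open import Data.Maybe using (Maybe; just; nothing)
open import Data.Bool using (Bool; true; false)
open import Data.Product using (Σ; _×_; _,_; proj₁; proj₂)
open import Data.Sum using (_⊎_)
open import Data.Empty using (⊥)
open import Relation.Nullary using (¬_)
open import Relation.Binary.PropositionalEquality using (_≡_)
open import Function.Definitions using (Injective)

-- Compound letters (directions): a tuple of local states indexed by
-- components 1..n (here Fin n) plus an (n+1)-th component of type X
-- (here index fromℕ n of Fin (suc n)).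

record CLetter {n : ℕ} (L : Fin n → Set) (X : Set) : Set where
  constructor clet
  field
    locs : (j : Fin n) → L j
    top  : X

data AgreeAt {n : ℕ} {L : Fin n → Set} {X : Set}
     : Fin (suc n) → CLetter L X → CLetter L X → Set where
  agree-loc  : ∀ {a b} (j : Fin n) →
               CLetter.locs a j ≡ CLetter.locs b j → AgreeAt (inject₁ j) a b
  agree-last : ∀ {a b} → CLetter.top a ≡ CLetter.top b → AgreeAt (fromℕ n) a b

mutual
  data SF (AP : Set) (k : ℕ) : Set where
    atom : AP → SF AP k
    ¬ₛ_  : SF AP k → SF AP k
    _∨ₛ_ : SF AP k → SF AP k → SF AP k
    E    : PF AP k → SF AP k
    ∃ᵒ   : Subset k → AP → SF AP k → SF AP k

  data PF (AP : Set) (k : ℕ) : Set where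
    st   : SF AP k → PF AP k
    ¬ₚ_  : PF AP k → PF AP k
    _∨ₚ_ : PF AP k → PF AP k → PF AP k
    X    : PF AP k → PF AP k
    _U_  : PF AP k → PF AP k → PF AP k

liftObs : ∀ {n} → Subset n → Subset (suc n)
liftObs {n} o = (o V.∷ʳ false) ∪ ⁅ fromℕ n ⁆

mutual
  liftS : ∀ {AP n} → SF AP n → SF AP (suc n)
  liftS (atom p)    = atom p
  liftS (¬ₛ φ)      = ¬ₛ liftS φ
  liftS (φ ∨ₛ ψ)    = liftS φ ∨ₛ liftS ψ
  liftS (E ψ)       = E (liftP ψ)
  liftS (∃ᵒ o p φ)  = ∃ᵒ (liftObs o) p (liftS φ)

  liftP : ∀ {AP n} → PF AP n → PF AP (suc n)
  liftP (st φ)   = st (liftS φ)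
  liftP (¬ₚ ψ)   = ¬ₚ liftP ψ
  liftP (ψ ∨ₚ χ) = liftP ψ ∨ₚ liftP χ
  liftP (X ψ)    = X (liftP ψ)
  liftP (ψ U χ)  = liftP ψ U liftP χ

-- Labelled trees. A node is a finite word over the alphabet A, stored
-- REVERSED (head = last letter), so the children of u are the a ∷ u.
-- lab u p : "p belongs to the label of u".

record LTree (AP A : Set) : Set₁ where
  field
    IsNode : List A → Set
    lab    : List A → AP → Set
open LTree

module Semantics {AP A : Set} {k : ℕ} (Agree : Fin k → A → A → Set) where

  AgreeOn : Subset k → A → A → Set
  AgreeOn o a b = ∀ i → i ∈ o → Agree i a b

  -- o-uniform labelling: equal on nodes of equal length whose letters
  -- pairwise agree on the components in o (Pointwise forces equal length)
  Uniform : LTree AP A → Subset k → (List A → Bool) → Set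
  Uniform T o f = ∀ u v → IsNode T u → IsNode T v →
                  Pointwise (AgreeOn o) u v → f u ≡ f v

  relabel : LTree AP A → AP → (List A → Bool) → LTree AP A
  relabel T p f = record
    { IsNode = IsNode T
    ; lab    = λ w q → (q ≡ p × f w ≡ true) ⊎ (¬ (q ≡ p) × lab T w q) }

  PathFrom : LTree AP A → List A → (ℕ → List A) → Set
  PathFrom T u π = (π 0 ≡ u) ×
    (∀ j → Σ A λ a → (π (suc j) ≡ a ∷ π j) × IsNode T (π (suc j)))

  shift : ℕ → (ℕ → List A) → (ℕ → List A)
  shift i π j = π (i + j)

  mutual
    ⟦_⟧ₛ : SF AP k → LTree AP A → List A → Set
    ⟦ atom p ⟧ₛ T u   = lab T u p
    ⟦ ¬ₛ φ ⟧ₛ T u     = ¬ (⟦ φ ⟧ₛ T u)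
    ⟦ φ ∨ₛ ψ ⟧ₛ T u   = ⟦ φ ⟧ₛ T u ⊎ ⟦ ψ ⟧ₛ T u
    ⟦ E ψ ⟧ₛ T u      = Σ (ℕ → List A) λ π → PathFrom T u π × ⟦ ψ ⟧ₚ T π
    ⟦ ∃ᵒ o p φ ⟧ₛ T u = Σ (List A → Bool) λ f →
                          Uniform T o f × ⟦ φ ⟧ₛ (relabel T p f) u

    ⟦_⟧ₚ : PF AP k → LTree AP A → (ℕ → List A) → Set
    ⟦ st φ ⟧ₚ T π   = ⟦ φ ⟧ₛ T (π 0)
    ⟦ ¬ₚ ψ ⟧ₚ T π   = ¬ (⟦ ψ ⟧ₚ T π)
    ⟦ ψ ∨ₚ χ ⟧ₚ T π = ⟦ ψ ⟧ₚ T π ⊎ ⟦ χ ⟧ₚ T π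
    ⟦ X ψ ⟧ₚ T π    = ⟦ ψ ⟧ₚ T (shift 1 π)
    ⟦ ψ U χ ⟧ₚ T π  = Σ ℕ λ j → ⟦ χ ⟧ₚ T (shift j π) ×
                        (∀ i → i < j → ⟦ ψ ⟧ₚ T (shift i π))

record DFA (Σ' : Set) : Set where
  field
    size  : ℕ
    init  : Fin size
    δ     : Fin size → Σ' → Fin size
    acc   : Fin size → Bool

accepts : ∀ {Σ'} → DFA Σ' → List Σ' → Bool
accepts M w = DFA.acc M (foldl (DFA.δ M) (DFA.init M) w)

-- Pushdown compound Kripke structures.
-- Γ = Fin g, Γ⊥ = Maybe (Fin g) with nothing = ⊥; S = Fin m, each state
-- being a tuple of local states via the injective map loc.

Γ⊥ : ℕ → Set
Γ⊥ g = Maybe (Fin g)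

toW : ∀ {g} → List (Fin g) → List (Γ⊥ g)
toW u = map just u L.∷ʳ nothing

Config : ℕ → ℕ → Set
Config m g = Fin m × List (Γ⊥ g)

Step : ∀ {m g} → (Fin m → Γ⊥ g → Fin m → List (Γ⊥ g) → Set) →
       Config m g → Config m g → Set
Step {m} {g} R (s , w) (s' , w₂) =
  Σ (Γ⊥ g) λ γ → Σ (List (Γ⊥ g)) λ pushed → Σ (List (Γ⊥ g)) λ rest →
    R s γ s' pushed × (w ≡ γ ∷ rest) × (w₂ ≡ pushed ++ rest)

record PCKS (n : ℕ) (L : Fin n → Set) (AP : Set) : Set₁ where
  field
    g       : ℕ
    m       : ℕ
    loc     : Fin m → (i : Fin n) → L i
    loc-inj : Injective _≡_ _≡_ loc
    R       : Fin m → Γ⊥ g → Fin m → List (Γ⊥ g) → Set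
    R-⊥     : ∀ {s s' w'} → R s nothing s' w' →
              Σ (List (Fin g)) λ u → w' ≡ toW u
    R-Γ     : ∀ {s γ s' w'} → R s (just γ) s' w' →
              Σ (List (Fin g)) λ u → w' ≡ map just u
    ℓ       : Fin m → List (Γ⊥ g) → AP → Bool
    ℓ-reg   : ∀ (p : AP) (s : Fin m) → Σ (DFA (Γ⊥ g)) λ M →
              ∀ (u : List (Fin g)) → accepts M (toW u) ≡ ℓ s (toW u) p
    sι      : Fin m
    total   : ∀ (s : Fin m) (u : List (Fin g)) →
              Σ (Config m g) λ c → Step R (s , toW u) c

module PCKSTrees {n : ℕ} {L : Fin n → Set} {AP : Set} (P : PCKS n L AP) where
  open PCKS P

  Cfg : Set
  Cfg = Config m g

  initCfg : Cfg
  initCfg = (sι , nothing ∷ [])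

  -- partial paths, stored reversed (head = last configuration)
  data IsPath : List Cfg → Set where
    start : IsPath (initCfg ∷ [])
    next  : ∀ {c c' u} → IsPath (c ∷ u) → Step R c c' → IsPath (c' ∷ c ∷ u)

  lastLab : List Cfg → AP → Set
  lastLab []            p = ⊥
  lastLab ((s , w) ∷ _) p = ℓ s w p ≡ true

  cksUnfolding : LTree AP Cfg
  cksUnfolding = record { IsNode = IsPath ; lab = lastLab }

  cksAgree : Fin (suc n) → Cfg → Cfg → Set
  cksAgree i (s , w) (s' , w') = AgreeAt i (clet (loc s) w) (clet (loc s') w')

  -- succinct representations (reversed): SuccRep u v
  SLetter : Set
  SLetter = Fin m × List (Γ⊥ g)

  data SuccRep : List Cfg → List SLetter → Set where
    root : SuccRep (initCfg ∷ []) ((sι , nothing ∷ []) ∷ [])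
    next : ∀ {s w s' w₂ u v γ w'' pushed} →
           SuccRep ((s , w) ∷ u) v → Step R (s , w) (s' , w₂) →
           w ≡ γ ∷ w'' → w₂ ≡ pushed ++ w'' →
           SuccRep ((s' , w₂) ∷ (s , w) ∷ u) ((s' , pushed) ∷ v)

  succinct : LTree AP SLetter
  succinct = record
    { IsNode = λ v → Σ (List Cfg) λ u → IsPath u × SuccRep u v
    ; lab    = λ v p → Σ (List Cfg) λ u → IsPath u × SuccRep u v × lastLab u p }

  succAgree : Fin (suc n) → SLetter → SLetter → Set
  succAgree i (s , w) (s' , w') = AgreeAt i (clet (loc s) w) (clet (loc s') w')

  module CS = Semantics {AP} {Cfg} cksAgree
  module SS = Semantics {AP} {SLetter} succAgree

  Models : SF AP n → Set
  Models φ = CS.⟦ liftS φ ⟧ₛ cksUnfolding (initCfg ∷ [])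

  SuccinctModels : SF AP (suc n) → Set
  SuccinctModels ψ = SS.⟦ ψ ⟧ₛ succinct ((sι , nothing ∷ []) ∷ [])

_⊨_ : ∀ {n L AP} → PCKS n L AP → SF AP n → Set
P ⊨ φ = PCKSTrees.Models P φ

_⊨succ_ : ∀ {n L AP} → PCKS n L AP → SF AP (suc n) → Set
P ⊨succ ψ = PCKSTrees.SuccinctModels P ψ

module Submission where

-- Partial paths of P and their succinct representations are in
-- bijection: a path determines the word pushed at each step, and conversely
-- replaying the pushed words rebuilds every stack.  The bijection maps
-- children to children, preserves the last configuration (hence labels),
-- and, although it changes the (n+1)-th component of each letter, it
-- preserves agreement on every observation containing n+1: given that the
-- previous stacks agree, two pushed words agree iff the resulting stacks do.
-- Only such observations occur in φ'.

open import Defs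
open import Data.Nat using (ℕ; zero; suc; _∸_; _+_)
open import Data.Nat.Properties using (m+n∸n≡m)
open import Data.Fin using (Fin; fromℕ)
open import Data.Fin.Properties using (fromℕ≢inject₁)
open import Data.Fin.Subset using (Subset; _∈_)
open import Data.Fin.Subset.Properties using (x∈⁅x⁆; x∈p∪q⁺)
open import Data.List using (List; []; _∷_; _++_; length; take)
open import Data.List.Properties using (length-++; ++-cancelʳ; ∷-injectiveʳ)
open import Data.List.Relation.Binary.Pointwise using (Pointwise; []; _∷_)
open import Data.Product using (Σ; _×_; _,_; proj₁; proj₂)
open import Data.Product.Function.NonDependent.Propositional using (_×-⇔_)
open import Data.Sum using (inj₂)
open import Data.Sum.Function.Propositional using (_⊎-⇔_)
open import Data.Bool using (Bool)
open import Data.Empty using (⊥-elim)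
open import Function using (_∘_)
open import Function.Bundles using (_⇔_; mk⇔; Equivalence)
import Function.Properties.Equivalence as ⇔
open import Function.Related.TypeIsomorphisms using (¬-cong-⇔)
open import Relation.Binary.PropositionalEquality
  using (_≡_; refl; sym; trans; cong; subst)

open Equivalence

-- Agreement of two letters on every component of an observation; this is
-- Semantics.AgreeOn, which does not depend on the labels of the tree.
AgreeOnObs : ∀ {k} {A : Set} → (Fin k → A → A → Set) → Subset k → A → A → Set
AgreeOnObs Agree o a b = ∀ i → i ∈ o → Agree i a b

last∈liftObs : ∀ {n} (o : Subset n) → fromℕ n ∈ liftObs o
last∈liftObs {n} o = x∈p∪q⁺ (inj₂ (x∈⁅x⁆ (fromℕ n)))

agreeAt-last : ∀ {n} {L : Fin n → Set} {X : Set} {i} {a b : CLetter L X} →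
               AgreeAt i a b → i ≡ fromℕ n → CLetter.top a ≡ CLetter.top b
agreeAt-last (agree-loc j _) i≡last = ⊥-elim (fromℕ≢inject₁ (sym i≡last))
agreeAt-last (agree-last e) _       = e

agreeAt-retop : ∀ {n} {L : Fin n → Set} {Y Z : Set} {i}
                {l l' : (j : Fin n) → L j} {t t' : Y} {r r' : Z} →
                AgreeAt i (clet l t) (clet l' t') → (t ≡ t' → r ≡ r') →
                AgreeAt i (clet l r) (clet l' r')
agreeAt-retop (agree-loc j e) _ = agree-loc j e
agreeAt-retop (agree-last e) f  = agree-last (f e)

agreeOn-retop : ∀ {n} {L : Fin n → Set} {Y Z : Set} {O : Subset (suc n)}
                {l l' : (j : Fin n) → L j} {t t' : Y} {r r' : Z} →
                fromℕ n ∈ O → (t ≡ t') ⇔ (r ≡ r') →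
                AgreeOnObs AgreeAt O (clet l t) (clet l' t') ⇔
                AgreeOnObs AgreeAt O (clet l r) (clet l' r')
agreeOn-retop last∈O t⇔r = mk⇔
  (λ h i i∈O → agreeAt-retop (h i i∈O) λ _ → to t⇔r (agreeAt-last (h _ last∈O) refl))
  (λ h i i∈O → agreeAt-retop (h i i∈O) λ _ → from t⇔r (agreeAt-last (h _ last∈O) refl))

record Correspondence {n : ℕ} {A B : Set}
       (AgreeA : Fin (suc n) → A → A → Set) (AgreeB : Fin (suc n) → B → B → Set)
       (NodeA : List A → Set) (NodeB : List B → Set) : Set₁ where
  field
    Rel       : List A → List B → Set
    enc       : List A → List B
    dec       : List B → List A
    rel-enc   : ∀ {u} → NodeA u → Rel u (enc u)
    rel-dec   : ∀ {v} → NodeB v → Rel (dec v) v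
    rel-nodeA : ∀ {u v} → Rel u v → NodeA u
    rel-nodeB : ∀ {u v} → Rel u v → NodeB v
    enc-rel   : ∀ {u v} → Rel u v → enc u ≡ v
    dec-rel   : ∀ {u v} → Rel u v → dec v ≡ u
    enc-child : ∀ a u → Σ B λ b → enc (a ∷ u) ≡ b ∷ enc u
    dec-child : ∀ b v → Σ A λ a → dec (b ∷ v) ≡ a ∷ dec v
    agree     : ∀ (o : Subset n) {u v u' v'} → Rel u v → Rel u' v' →
                Pointwise (AgreeOnObs AgreeA (liftObs o)) u u' ⇔
                Pointwise (AgreeOnObs AgreeB (liftObs o)) v v'

-- The inverse correspondence; it lets every transport lemma be proved once.
flip : ∀ {n A B AgreeA AgreeB NodeA NodeB} →
       Correspondence {n} {A} {B} AgreeA AgreeB NodeA NodeB →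
       Correspondence AgreeB AgreeA NodeB NodeA
flip C = record
  { Rel = λ v u → Rel u v ; enc = dec ; dec = enc
  ; rel-enc = rel-dec ; rel-dec = rel-enc
  ; rel-nodeA = rel-nodeB ; rel-nodeB = rel-nodeA
  ; enc-rel = dec-rel ; dec-rel = enc-rel
  ; enc-child = dec-child ; dec-child = enc-child
  ; agree = λ o r r' → ⇔.sym (agree o r r') }
  where open Correspondence C

module Transport {n : ℕ} {AP A B : Set}
       (AgreeA : Fin (suc n) → A → A → Set) (AgreeB : Fin (suc n) → B → B → Set) where
  module SA = Semantics {AP} {A} AgreeA
  module SB = Semantics {AP} {B} AgreeB
  open LTree

  Corr : LTree AP A → LTree AP B → Set₁
  Corr T₁ T₂ = Correspondence AgreeA AgreeB (IsNode T₁) (IsNode T₂)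

  LabelsAgree : (List A → List B → Set) →
                (List A → AP → Set) → (List B → AP → Set) → Set
  LabelsAgree Rel lab₁ lab₂ = ∀ {u v} → Rel u v → ∀ p → lab₁ u p ⇔ lab₂ v p

  mapPath : ∀ {T₁ T₂} (C : Corr T₁ T₂) {u v π} → Correspondence.Rel C u v →
            SA.PathFrom T₁ u π →
            SB.PathFrom T₂ v (Correspondence.enc C ∘ π) ×
            (∀ j → Correspondence.Rel C (π j) (Correspondence.enc C (π j)))
  mapPath {T₂ = T₂} C {u} {v} {π} r (π0≡u , step) = (trans (cong enc π0≡u) (enc-rel r) , step′) , related
    where
    open Correspondence C
    related : ∀ j → Rel (π j) (enc (π j))
    related zero    = subst (λ x → Rel x (enc x)) (sym π0≡u)
                            (subst (Rel u) (sym (enc-rel r)) r)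
    related (suc j) = rel-enc (proj₂ (proj₂ (step j)))
    step′ : ∀ j → Σ B λ b → (enc (π (suc j)) ≡ b ∷ enc (π j)) × IsNode T₂ (enc (π (suc j)))
    step′ j with step j
    ... | a , π₊≡aπ , _ with enc-child a (π j)
    ...   | b , eb = b , trans (cong enc π₊≡aπ) eb , rel-nodeB (related (suc j))

  mapUniform : ∀ {T₁ T₂} (C : Corr T₁ T₂) (o : Subset n) {f : List A → Bool} →
               SA.Uniform T₁ (liftObs o) f →
               SB.Uniform T₂ (liftObs o) (f ∘ Correspondence.dec C)
  mapUniform C o unif v₁ v₂ node₁ node₂ pw =
    unif (dec v₁) (dec v₂) (rel-nodeA (rel-dec node₁)) (rel-nodeA (rel-dec node₂))
         (from (agree o (rel-dec node₁) (rel-dec node₂)) pw)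
    where open Correspondence C

  relabel-agree : ∀ {T₁ T₂} (C : Corr T₁ T₂) p {f₁ f₂} →
                  LabelsAgree (Correspondence.Rel C) (lab T₁) (lab T₂) →
                  (∀ {u v} → Correspondence.Rel C u v → f₁ u ≡ f₂ v) →
                  LabelsAgree (Correspondence.Rel C) (lab (SA.relabel T₁ p f₁)) (lab (SB.relabel T₂ p f₂))
  relabel-agree C p labels f≡ r q =
    (⇔.refl ×-⇔ mk⇔ (trans (sym (f≡ r))) (trans (f≡ r))) ⊎-⇔ (⇔.refl ×-⇔ labels r q)

module Invariance {n : ℕ} {AP A B : Set}
       (AgreeA : Fin (suc n) → A → A → Set) (AgreeB : Fin (suc n) → B → B → Set) where
  open Transport {n} {AP} AgreeA AgreeB
  module Back = Transport {n} {AP} AgreeB AgreeA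
  open LTree
  open Correspondence

  mutual
    invariantS : ∀ (φ : SF AP n) {T₁ T₂} (C : Corr T₁ T₂) →
                 LabelsAgree (Rel C) (lab T₁) (lab T₂) → ∀ {u v} → Rel C u v →
                 SA.⟦ liftS φ ⟧ₛ T₁ u ⇔ SB.⟦ liftS φ ⟧ₛ T₂ v
    invariantS (atom p)    C labels r = labels r p
    invariantS (¬ₛ φ)      C labels r = ¬-cong-⇔ (invariantS φ C labels r)
    invariantS (φ ∨ₛ ψ)    C labels r = invariantS φ C labels r ⊎-⇔ invariantS ψ C labels r
    invariantS (E ψ) {T₁} {T₂} C labels r = mk⇔
      (λ { (π , path , sat) → let (path′ , related) = mapPath {T₁} {T₂} C r path in
           enc C ∘ π , path′ , to (invariantP ψ C labels related) sat })
      (λ { (π , path , sat) → let (path′ , related) = Back.mapPath {T₂} {T₁} (flip C) r path in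
           dec C ∘ π , path′ , from (invariantP ψ C labels related) sat })
    invariantS (∃ᵒ o p φ) {T₁} {T₂} C labels r = mk⇔
      (λ { (f , unif , sat) → f ∘ dec C , mapUniform {T₁} {T₂} C o unif ,
           to (invariantS φ C (relabel-agree C p labels (cong f ∘ sym ∘ dec-rel C)) r) sat })
      (λ { (f , unif , sat) → f ∘ enc C , Back.mapUniform {T₂} {T₁} (flip C) o unif ,
           from (invariantS φ C (relabel-agree C p labels (cong f ∘ enc-rel C)) r) sat })

    invariantP : ∀ (ψ : PF AP n) {T₁ T₂} (C : Corr T₁ T₂) →
                 LabelsAgree (Rel C) (lab T₁) (lab T₂) → ∀ {π₁ π₂} →
                 (∀ j → Rel C (π₁ j) (π₂ j)) →
                 SA.⟦ liftP ψ ⟧ₚ T₁ π₁ ⇔ SB.⟦ liftP ψ ⟧ₚ T₂ π₂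
    invariantP (st φ)   C labels rs = invariantS φ C labels (rs 0)
    invariantP (¬ₚ ψ)   C labels rs = ¬-cong-⇔ (invariantP ψ C labels rs)
    invariantP (ψ ∨ₚ χ) C labels rs = invariantP ψ C labels rs ⊎-⇔ invariantP χ C labels rs
    invariantP (X ψ)    C labels rs = invariantP ψ C labels (rs ∘ suc)
    invariantP (ψ U χ) {T₁} {T₂} C labels {π₁} {π₂} rs = mk⇔
      (λ { (j , now , before) → j , to (atχ j) now , λ i i<j → to (atψ i) (before i i<j) })
      (λ { (j , now , before) → j , from (atχ j) now , λ i i<j → from (atψ i) (before i i<j) })
      where
      atψ : ∀ j → SA.⟦ liftP ψ ⟧ₚ T₁ (SA.shift j π₁) ⇔ SB.⟦ liftP ψ ⟧ₚ T₂ (SB.shift j π₂)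
      atχ : ∀ j → SA.⟦ liftP χ ⟧ₚ T₁ (SA.shift j π₁) ⇔ SB.⟦ liftP χ ⟧ₚ T₂ (SB.shift j π₂)
      atψ j = invariantP ψ C labels (rs ∘ (j +_))
      atχ j = invariantP χ C labels (rs ∘ (j +_))

-- The word pushed by a step is recovered from the new stack and the part of
-- the old stack left untouched.
take-pushed : ∀ {X : Set} (pushed rest : List X) →
              take (length (pushed ++ rest) ∸ length rest) (pushed ++ rest) ≡ pushed
take-pushed pushed rest rewrite length-++ pushed {rest} | m+n∸n≡m (length pushed) (length rest) =
  take-prefix pushed
  where
  take-prefix : ∀ xs → take (length xs) (xs ++ rest) ≡ xs
  take-prefix []       = refl
  take-prefix (x ∷ xs) = cong (x ∷_) (take-prefix xs)

pushed-agree : ∀ {X : Set} {p p' r r' : List X} → r ≡ r' → (p ++ r ≡ p' ++ r') ⇔ (p ≡ p')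
pushed-agree {p = p} {p'} {r} refl = mk⇔ (++-cancelʳ r p p') (cong (_++ r))

module SuccinctUnfolding {n : ℕ} {L : Fin n → Set} {AP : Set} (P : PCKS n L AP) where
  open PCKS P
  open PCKSTrees P

  belowTop : List Cfg → List (Γ⊥ g)
  belowTop ((_ , _ ∷ rest) ∷ _) = rest
  belowTop _                    = []

  toSuccinct : List Cfg → List SLetter
  toSuccinct []                  = []
  toSuccinct (c ∷ [])            = c ∷ []
  toSuccinct ((s , w) ∷ c ∷ u)   =
    (s , take (length w ∸ length (belowTop (c ∷ u))) w) ∷ toSuccinct (c ∷ u)

  fromSuccinct : List SLetter → List Cfg
  fromSuccinct []                = []
  fromSuccinct (b ∷ [])          = b ∷ []
  fromSuccinct ((s , p) ∷ b ∷ v) =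
    (s , p ++ belowTop (fromSuccinct (b ∷ v))) ∷ fromSuccinct (b ∷ v)

  toSuccinct-child : ∀ c u → Σ SLetter λ b → toSuccinct (c ∷ u) ≡ b ∷ toSuccinct u
  toSuccinct-child c []      = c , refl
  toSuccinct-child _ (_ ∷ _) = _ , refl

  fromSuccinct-child : ∀ b v → Σ Cfg λ c → fromSuccinct (b ∷ v) ≡ c ∷ fromSuccinct v
  fromSuccinct-child b []      = b , refl
  fromSuccinct-child _ (_ ∷ _) = _ , refl

  toSuccinct-rep : ∀ {u v} → SuccRep u v → toSuccinct u ≡ v
  toSuccinct-rep root = refl
  toSuccinct-rep (next {w'' = rest} {pushed = p} r _ refl refl)
    rewrite take-pushed p rest | toSuccinct-rep r = refl

  fromSuccinct-rep : ∀ {u v} → SuccRep u v → fromSuccinct v ≡ u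
  fromSuccinct-rep root = refl
  fromSuccinct-rep (next r _ refl refl) = replay r (fromSuccinct-rep r)
    where
    replay : ∀ {u v s p} → SuccRep u v → fromSuccinct v ≡ u →
             fromSuccinct ((s , p) ∷ v) ≡ (s , p ++ belowTop u) ∷ u
    replay {v = _ ∷ _} _ refl = refl

  succRep-path : ∀ {u} → IsPath u → SuccRep u (toSuccinct u)
  succRep-path start = root
  succRep-path (next path (γ , p , rest , r , refl , refl))
    rewrite take-pushed p rest =
    next (succRep-path path) (γ , p , rest , r , refl , refl) refl refl

  agree-succRep : ∀ (o : Subset n) {u v u' v'} → SuccRep u v → SuccRep u' v' →
                  Pointwise (CS.AgreeOn (liftObs o)) u u' ⇔
                  Pointwise (SS.AgreeOn (liftObs o)) v v'
  agree-succRep o root root = mk⇔ (λ { (h ∷ []) → h ∷ [] }) (λ { (h ∷ []) → h ∷ [] })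
  agree-succRep o root (next root _ _ _)                 = mk⇔ (λ { (_ ∷ ()) }) (λ { (_ ∷ ()) })
  agree-succRep o root (next (next _ _ _ _) _ _ _)       = mk⇔ (λ { (_ ∷ ()) }) (λ { (_ ∷ ()) })
  agree-succRep o (next root _ _ _) root                 = mk⇔ (λ { (_ ∷ ()) }) (λ { (_ ∷ ()) })
  agree-succRep o (next (next _ _ _ _) _ _ _) root       = mk⇔ (λ { (_ ∷ ()) }) (λ { (_ ∷ ()) })
  agree-succRep o (next r _ refl refl) (next r' _ refl refl) = mk⇔
    (λ { (h ∷ t) → to (lastStep (untouched t)) h ∷ to earlier t })
    (λ { (h ∷ t) → let t′ = from earlier t in from (lastStep (untouched t′)) h ∷ t′ })
    where
    earlier = agree-succRep o r r'
    lastStep = λ e → agreeOn-retop (last∈liftObs o) (pushed-agree e)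
    untouched : ∀ {s s' γ γ' rest rest' u u'} →
                Pointwise (CS.AgreeOn (liftObs o)) ((s , γ ∷ rest) ∷ u) ((s' , γ' ∷ rest') ∷ u') →
                rest ≡ rest'
    untouched (h ∷ _) = ∷-injectiveʳ (agreeAt-last (h _ (last∈liftObs o)) refl)

  pathsVsSuccinct : Correspondence cksAgree succAgree (LTree.IsNode cksUnfolding)
                                                     (LTree.IsNode succinct)
  pathsVsSuccinct = record
    { Rel = λ u v → IsPath u × SuccRep u v
    ; enc = toSuccinct ; dec = fromSuccinct
    ; rel-enc = λ path → path , succRep-path path
    ; rel-dec = λ { {v} (u , rel) → subst (λ x → IsPath x × SuccRep x v)
                                           (sym (fromSuccinct-rep (proj₂ rel))) rel }
    ; rel-nodeA = proj₁ ; rel-nodeB = λ {u} rel → u , rel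
    ; enc-rel = toSuccinct-rep ∘ proj₂ ; dec-rel = fromSuccinct-rep ∘ proj₂
    ; enc-child = toSuccinct-child ; dec-child = fromSuccinct-child
    ; agree = λ o r r' → agree-succRep o (proj₂ r) (proj₂ r') }

  labels : Transport.LabelsAgree cksAgree succAgree (Correspondence.Rel pathsVsSuccinct)
             (LTree.lab cksUnfolding) (LTree.lab succinct)
  labels {u} (path , rep) p = mk⇔ (λ l → u , path , rep , l)
    (λ { (u' , _ , rep' , l) → subst (λ x → lastLab x p)
           (trans (sym (fromSuccinct-rep rep')) (fromSuccinct-rep rep)) l })

lemma4p2 : ∀ {n : ℕ} {L : Fin n → Set} {AP : Set} (P : PCKS n L AP) (φ : SF AP n) →
           (P ⊨ φ) ⇔ (P ⊨succ liftS φ)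
lemma4p2 P φ = invariantS φ pathsVsSuccinct labels (start , root)
  where
  open PCKSTrees P
  open SuccinctUnfolding P
  open Invariance cksAgree succAgree
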